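{- Let $\Gamma$ be a distance-regular graph and $\theta_i(\Gamma)$ a rational eigenvalue of $\Gamma$. Then $m(i,\Gamma)\ge 2$, and $m(i,\Gamma)=2$ if and only if there is a completely regular code in $\Gamma$ with covering radius $\rho=1$, intersection array $\{\beta_0;\beta_0\}$ (i.e. $\gamma_1=\beta_0$) and eigenvalue $\theta_i(\Gamma)$.
   Context: A regular graph of diameter $d$ is distance-regular if there are integers $\beta_0,\dots,\beta_{d-1},\gamma_1,\dots,\gamma_d$ such that for any vertices $x,y$ at distance $i$, $y$ has exactly $\beta_i$ neighbours at distance $i+1$ from $x$ and $\gamma_i$ neighbours at distance $i-1$ from $x$. It has $d+1$ distinct eigenvalues $\theta_0>\dots>\theta_d$. A $\theta$-eigenvector is a nonzero $v$ with $Av=\theta v$. NZI means all entries nonzero integers; $m(i,\Gamma)=\min\{\|u\|_\infty+1: u\text{ an NZI }\theta_i(\Gamma)\text{ -eigenvector of }\Gamma\}$ (such vectors exist for rational eigenvalues). For $C\subseteq V(\Gamma)$ let $C_i=\{x:d(x,C)=i\}$ and $\rho$ the largest $i$ with $C_i\ne\emptyset$ (covering radius). $C$ is a completely regular code if there are numbers $\alpha_i,\beta_i,\gamma_i$ such that every vertex of $C_i$ has exactly $\alpha_i,\beta_i,\gamma_i$ neighbours in $C_i,C_{i+1},C_{i-1}$ respectively; its intersection array is $\{\beta_0,\dots,\beta_{\rho-1};\gamma_1,\dots,\gamma_\rho\}$, and its eigenvalues are the eigenvalues of the tridiagonal matrix with diagonal $\alpha_0,\dots,\alpha_\rho$, superdiagonal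 $\beta_0,\dots,\beta_{\rho-1}$ and subdiagonal $\gamma_1,\dots,\gamma_\rho$. -}

module Defs where

open import Data.Bool using (Bool; true; false; _∧_; _∨_; not; if_then_else_)
open import Data.Nat using (ℕ; zero; suc; _≤_; _<_; _⊔_; _≡ᵇ_)
import Data.Nat as ℕ
open import Data.Integer using (ℤ)
import Data.Integer as ℤ
open import Data.Rational using (ℚ; 0ℚ; _+_; _*_; _/_)
import Data.Rational as ℚ
open import Data.Fin using (Fin; toℕ)
import Data.Fin as Fin
open import Data.Fin.Subset using (Subset; ∣_∣)
open import Data.Vec using (tabulate; lookup)
open import Data.Product using (Σ; ∃; _×_)
open import Relation.Nullary using (¬_; does)
open import Relation.Binary.PropositionalEquality using (_≡_)

record Graph (n : ℕ) : Set where
  field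
    adj    : Fin n → Fin n → Bool
    symm   : ∀ x y → adj x y ≡ adj y x
    irrefl : ∀ x → adj x x ≡ false
open Graph public

anyF : ∀ {n} → (Fin n → Bool) → Bool
anyF {zero}  p = false
anyF {suc n} p = p Fin.zero ∨ anyF (λ z → p (Fin.suc z))

cnt : ∀ {n} → (Fin n → Bool) → ℕ
cnt p = ∣ tabulate p ∣

sumF : ∀ {n} → (Fin n → ℚ) → ℚ
sumF {zero}  f = 0ℚ
sumF {suc n} f = f Fin.zero + sumF (λ z → f (Fin.suc z))

maxF : ∀ {n} → (Fin n → ℕ) → ℕ
maxF {zero}  f = 0
maxF {suc n} f = f Fin.zero ⊔ maxF (λ z → f (Fin.suc z))

module _ {n : ℕ} (G : Graph n) where

  walk : ℕ → Fin n → Fin n → Bool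
  walk zero    x y = does (x Fin.≟ y)
  walk (suc k) x y = anyF (λ z → adj G x z ∧ walk k z y)

  within : ℕ → Fin n → Fin n → Bool
  within zero    x y = walk zero x y
  within (suc k) x y = within k x y ∨ walk (suc k) x y

  distIs : ℕ → Fin n → Fin n → Bool
  distIs zero    x y = within zero x y
  distIs (suc i) x y = within (suc i) x y ∧ not (within i x y)

  withinSet : Subset n → ℕ → Fin n → Bool
  withinSet C k x = anyF (λ c → lookup C c ∧ within k x c)

  -- x ∈ C_i, i.e. d(x,C) = i
  inLayer : Subset n → ℕ → Fin n → Bool
  inLayer C zero    x = withinSet C zero x
  inLayer C (suc i) x = withinSet C (suc i) x ∧ not (withinSet C i x)

  Connected : Set
  Connected = ∀ x y → ∃ λ i → distIs i x y ≡ true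

  Regular : ℕ → Set
  Regular k = ∀ x → cnt (adj G x) ≡ k

  DistanceRegular : Set
  DistanceRegular =
    Connected × (∃ λ k → Regular k) ×
    (Σ (ℕ → ℕ) λ b → Σ (ℕ → ℕ) λ c →
      (∀ x y i → distIs i x y ≡ true →
         cnt (λ z → adj G y z ∧ distIs (suc i) x z) ≡ b i) ×
      (∀ x y i → distIs (suc i) x y ≡ true →
         cnt (λ z → adj G y z ∧ distIs i x z) ≡ c (suc i)))

  applyA : (Fin n → ℚ) → Fin n → ℚ
  applyA v x = sumF (λ y → if adj G x y then v y else 0ℚ)

  IsEigenvalue : ℚ → Set
  IsEigenvalue θ = Σ (Fin n → ℚ) λ v →
    (∃ λ x → ¬ (v x ≡ 0ℚ)) × (∀ x → applyA v x ≡ θ * v x)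

  NZIEigenvector : ℚ → (Fin n → ℤ) → Set
  NZIEigenvector θ u =
    (∀ x → ¬ (u x ≡ ℤ.0ℤ)) ×
    (∀ x → applyA (λ y → u y / 1) x ≡ θ * (u x / 1))

  supNorm : (Fin n → ℤ) → ℕ
  supNorm u = maxF (λ x → ℤ.∣ u x ∣)

  -- m(i,Γ) = m, where θ = θ_i(Γ)
  IsM : ℚ → ℕ → Set
  IsM θ m =
    (Σ (Fin n → ℤ) λ u → NZIEigenvector θ u × m ≡ suc (supNorm u)) ×
    (∀ u → NZIEigenvector θ u → m ≤ suc (supNorm u))

  CompletelyRegular : Subset n → (ρ : ℕ) → (α β γ : ℕ → ℕ) → Set
  CompletelyRegular C ρ α β γ =
    (∃ λ x → inLayer C ρ x ≡ true) ×
    (∀ j x → ρ < j → inLayer C j x ≡ false) ×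
    (∀ i x → i ≤ ρ → inLayer C i x ≡ true →
       cnt (λ z → adj G x z ∧ inLayer C i z) ≡ α i ×
       cnt (λ z → adj G x z ∧ inLayer C (suc i) z) ≡ β i) ×
    (∀ i x → suc i ≤ ρ → inLayer C (suc i) x ≡ true →
       cnt (λ z → adj G x z ∧ inLayer C i z) ≡ γ (suc i))

-- entries of the tridiagonal (ρ+1)×(ρ+1) matrix with diagonal α_0..α_ρ,
-- superdiagonal β_0..β_{ρ-1}, subdiagonal γ_1..γ_ρ
tridiag : (ρ : ℕ) → (α β γ : ℕ → ℕ) → Fin (suc ρ) → Fin (suc ρ) → ℚ
tridiag ρ α β γ j l =
  if toℕ l ≡ᵇ toℕ j then ℤ.+ (α (toℕ j)) / 1
  else if toℕ l ≡ᵇ suc (toℕ j) then ℤ.+ (β (toℕ j)) / 1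
  else if suc (toℕ l) ≡ᵇ toℕ j then ℤ.+ (γ (toℕ j)) / 1
  else 0ℚ

CodeEigenvalue : (ρ : ℕ) → (α β γ : ℕ → ℕ) → ℚ → Set
CodeEigenvalue ρ α β γ θ = Σ (Fin (suc ρ) → ℚ) λ w →
  (∃ λ j → ¬ (w j ≡ 0ℚ)) ×
  (∀ j → sumF (λ l → tridiag ρ α β γ j l * w l) ≡ θ * w j)

-- A ±1 eigenvector is the signed indicator of a bipartition P of the vertices. In a
-- k-regular graph the eigenvalue equation at x says that x has a = (k + θ)/2 neighbours
-- on its own side of P and b = (k - θ)/2 on the other, so the bipartition is equitable
-- with quotient matrix [[a, b], [b, a]]; b ≠ 0 because θ is below the largest eigenvalue,
-- which is at most k. Hence every vertex outside P has a neighbour in P, and P is a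
-- completely regular code of covering radius 1 with intersection array {b; b} and
-- eigenvalue a - b = θ. Conversely, in a connected graph such a code and its complement
-- form an equitable bipartition with the same quotient matrix, whose eigenvalue θ ≠ k
-- must be a - b, so the ±1 indicator of the code is a θ-eigenvector. Finally m ≥ 2
-- because the entries of an NZI vector are nonzero integers.

module Submission where

open import Defs
open import Data.Bool using (Bool; true; false; _∧_; _∨_; not; _xor_; if_then_else_)
open import Data.Bool.Properties using (not-involutive; ∧-identityʳ; ∧-zeroʳ)
open import Data.Empty using (⊥-elim)
open import Data.Fin as Fin using (Fin)
open import Data.Fin.Subset using (Subset)
open import Data.Integer as ℤ using (ℤ; +_; -[1+_])
import Data.Integer.Properties as ℤP
open import Data.Integer.Tactic.RingSolver using (solve-∀)
open import Data.List using (allFin)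
open import Data.List.Membership.Propositional.Properties using (∈-allFin)
import Data.List.Relation.Unary.All as All
open import Data.Nat as ℕ using (ℕ; zero; suc; _≤_; _<_; z≤n; s≤s)
import Data.Nat.Properties as ℕP
open import Data.Product using (Σ; ∃; _×_; _,_; proj₁; proj₂)
open import Data.Rational as ℚ using (ℚ; 0ℚ; 1ℚ; _+_; _*_; _-_; -_; _/_)
open import Data.Rational.Literals using (fromℤ)
import Data.Rational.Properties as ℚP
import Data.Rational.Unnormalised as ℚᵘ
import Data.Rational.Unnormalised.Properties as ℚᵘP
open import Data.Rational.Solver using (module +-*-Solver)
open import Data.Vec using (tabulate; lookup)
open import Data.Vec.Properties using (lookup∘tabulate; tabulate-cong)
open import Function using (_∘_; const)
open import Function.Bundles using (_⇔_; mk⇔)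
open import Relation.Binary.Definitions using (tri<; tri≈; tri>)
open import Relation.Binary.PropositionalEquality
open import Relation.Nullary using (¬_; does; yes)
open import Relation.Nullary.Decidable using (dec-true)
open import Relation.Binary.Bundles using (DecTotalOrder)
open import Data.List.Extrema (DecTotalOrder.totalOrder ℚP.≤-decTotalOrder)
  using (argmax; f[⊥]≤f[argmax]; f[xs]≤f[argmax])

open +-*-Solver using (solve; _:=_; _:+_; _:-_; _:*_; :-_; con)

/1≡fromℤ : ∀ i → i / 1 ≡ fromℤ i
/1≡fromℤ i = ℚP.↥p/↧p≡p (fromℤ i)

fromℤ-+ : ∀ i j → fromℤ (i ℤ.+ j) ≡ fromℤ i + fromℤ j
fromℤ-+ i j = ℚP.toℚᵘ-injective (ℚᵘP.≃-sym
  (ℚᵘP.≃-trans (ℚP.toℚᵘ-homo-+ (fromℤ i) (fromℤ j)) (ℚᵘ.*≡* (identity i j))))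
  where
  identity : ∀ i j → (i ℤ.* + 1 ℤ.+ j ℤ.* + 1) ℤ.* + 1 ≡ (i ℤ.+ j) ℤ.* (+ 1 ℤ.* + 1)
  identity = solve-∀

-- Opaque: unfolding the gcd normalisation hidden in _/_ makes type checking blow up.
opaque
  fromℕ : ℕ → ℚ
  fromℕ n = + n / 1

  fromℕ≡/1 : ∀ n → fromℕ n ≡ + n / 1
  fromℕ≡/1 n = refl

  fromℕ-0 : fromℕ 0 ≡ 0ℚ
  fromℕ-0 = refl

  fromℕ-1 : fromℕ 1 ≡ 1ℚ
  fromℕ-1 = refl

fromℕ≡fromℤ : ∀ n → fromℕ n ≡ fromℤ (+ n)
fromℕ≡fromℤ n = trans (fromℕ≡/1 n) (/1≡fromℤ (+ n))

fromℕ-+ : ∀ m n → fromℕ (m ℕ.+ n) ≡ fromℕ m + fromℕ n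
fromℕ-+ m n = begin
  fromℕ (m ℕ.+ n)           ≡⟨ fromℕ≡fromℤ (m ℕ.+ n) ⟩
  fromℤ (+ m ℤ.+ + n)       ≡⟨ fromℤ-+ (+ m) (+ n) ⟩
  fromℤ (+ m) + fromℤ (+ n) ≡⟨ sym (cong₂ _+_ (fromℕ≡fromℤ m) (fromℕ≡fromℤ n)) ⟩
  fromℕ m + fromℕ n         ∎
  where open ≡-Reasoning

fromℕ-suc : ∀ n → fromℕ (suc n) ≡ 1ℚ + fromℕ n
fromℕ-suc n = trans (fromℕ-+ 1 n) (cong (_+ fromℕ n) fromℕ-1)

1+difference : ∀ s t → 1ℚ + (fromℕ s - fromℕ t) ≡ fromℕ (suc s) - fromℕ t
1+difference s t = trans (shift (fromℕ s) (fromℕ t)) (cong (_- fromℕ t) (sym (fromℕ-suc s)))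
  where
  shift : ∀ s t → 1ℚ + (s - t) ≡ (1ℚ + s) - t
  shift = solve 2 (λ s t → con 1ℚ :+ (s :- t) := (con 1ℚ :+ s) :- t) refl

-1+difference : ∀ s t → - 1ℚ + (fromℕ s - fromℕ t) ≡ fromℕ s - fromℕ (suc t)
-1+difference s t =
  trans (shift (fromℕ s) (fromℕ t)) (cong (λ q → fromℕ s - q) (sym (fromℕ-suc t)))
  where
  shift : ∀ s t → - 1ℚ + (s - t) ≡ s - (1ℚ + t)
  shift = solve 2 (λ s t → :- con 1ℚ :+ (s :- t) := s :- (con 1ℚ :+ t)) refl

fromℕ-injective : ∀ {m n} → fromℕ m ≡ fromℕ n → m ≡ n
fromℕ-injective {m} {n} e =
  ℤP.+-injective (cong ℚ.↥_ (trans (sym (fromℕ≡fromℤ m)) (trans e (fromℕ≡fromℤ n))))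

y*x≡0⇒y≡0 : ∀ {x y} → x ≢ 0ℚ → y * x ≡ 0ℚ → y ≡ 0ℚ
y*x≡0⇒y≡0 {x} {y} x≢0 yx≡0 = begin
  y               ≡⟨ sym (ℚP.*-identityʳ y) ⟩
  y * 1ℚ          ≡⟨ cong (y *_) (sym (ℚP.*-inverseʳ x)) ⟩
  y * (x * x⁻¹)   ≡⟨ sym (ℚP.*-assoc y x x⁻¹) ⟩
  (y * x) * x⁻¹   ≡⟨ cong (_* x⁻¹) yx≡0 ⟩
  0ℚ * x⁻¹        ≡⟨ ℚP.*-zeroˡ x⁻¹ ⟩
  0ℚ              ∎
  where
  open ≡-Reasoning
  instance
    x-nonZero : ℚ.NonZero x
    x-nonZero = ℚ.≢-nonZero x≢0
  x⁻¹ : ℚ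
  x⁻¹ = ℚ.1/ x

-- [[a, b], [b, a]] has the eigenvalues a + b, for (1, 1), and a - b, for (1, -1).
symmetric-eigenvalue : ∀ a b {θ w₀ w₁} →
  a * w₀ + (b * w₁ + 0ℚ) ≡ θ * w₀ → b * w₀ + (a * w₁ + 0ℚ) ≡ θ * w₁ →
  ¬ (w₀ ≡ 0ℚ × w₁ ≡ 0ℚ) → θ ≢ a + b → θ ≡ a - b
symmetric-eigenvalue a b {θ} {w₀} {w₁} row₀ row₁ w≢0 θ≢a+b =
  difference≡0 (y*x≡0⇒y≡0 w₀≢0 (begin
    ((a - b) - θ) * w₀                      ≡⟨ antisymmetric-part a b θ w₀ w₁ ⟩
    (a * w₀ + (b * w₁ + 0ℚ) - θ * w₀) - b * (w₀ + w₁)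
                                            ≡⟨ cong₂ (λ r s → r - θ * w₀ - b * s) row₀ w₀+w₁≡0 ⟩
    (θ * w₀ - θ * w₀) - b * 0ℚ              ≡⟨ cancel (θ * w₀) b ⟩
    0ℚ                                      ∎))
  where
  open ≡-Reasoning
  difference≡0 : ∀ {x y} → y - x ≡ 0ℚ → x ≡ y
  difference≡0 {x} {y} e = begin
    x              ≡⟨ recover x y ⟩
    y - (y - x)    ≡⟨ cong (λ t → y - t) e ⟩
    y - 0ℚ         ≡⟨ ℚP.+-identityʳ y ⟩
    y              ∎
    where
    recover : ∀ x y → x ≡ y - (y - x)
    recover = solve 2 (λ x y → x := y :- (y :- x)) refl
  symmetric-part : ∀ a b θ w₀ w₁ →
    ((a + b) - θ) * (w₀ + w₁) ≡
    (a * w₀ + (b * w₁ + 0ℚ) - θ * w₀) + (b * w₀ + (a * w₁ + 0ℚ) - θ * w₁)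
  symmetric-part = solve 5 (λ a b θ w₀ w₁ → ((a :+ b) :- θ) :* (w₀ :+ w₁) :=
    (a :* w₀ :+ (b :* w₁ :+ con 0ℚ) :- θ :* w₀) :+
    (b :* w₀ :+ (a :* w₁ :+ con 0ℚ) :- θ :* w₁)) refl
  antisymmetric-part : ∀ a b θ w₀ w₁ →
    ((a - b) - θ) * w₀ ≡ (a * w₀ + (b * w₁ + 0ℚ) - θ * w₀) - b * (w₀ + w₁)
  antisymmetric-part = solve 5 (λ a b θ w₀ w₁ → ((a :- b) :- θ) :* w₀ :=
    (a :* w₀ :+ (b :* w₁ :+ con 0ℚ) :- θ :* w₀) :- b :* (w₀ :+ w₁)) refl
  cancel : ∀ x b → (x - x) - b * 0ℚ ≡ 0ℚ
  cancel = solve 2 (λ x b → (x :- x) :- b :* con 0ℚ := con 0ℚ) refl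
  cancel₂ : ∀ x y → (x - x) + (y - y) ≡ 0ℚ
  cancel₂ = solve 2 (λ x y → (x :- x) :+ (y :- y) := con 0ℚ) refl
  w₀+w₁≡0 : w₀ + w₁ ≡ 0ℚ
  w₀+w₁≡0 = y*x≡0⇒y≡0 (θ≢a+b ∘ difference≡0) (begin
    (w₀ + w₁) * ((a + b) - θ)   ≡⟨ ℚP.*-comm (w₀ + w₁) _ ⟩
    ((a + b) - θ) * (w₀ + w₁)   ≡⟨ symmetric-part a b θ w₀ w₁ ⟩
    _                           ≡⟨ cong₂ (λ r s → (r - θ * w₀) + (s - θ * w₁)) row₀ row₁ ⟩
    (θ * w₀ - θ * w₀) + (θ * w₁ - θ * w₁) ≡⟨ cancel₂ (θ * w₀) (θ * w₁) ⟩
    0ℚ                          ∎)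
  w₀≢0 : w₀ ≢ 0ℚ
  w₀≢0 w₀≡0 = w≢0 (w₀≡0 , (begin
    w₁              ≡⟨ sym (ℚP.+-identityˡ w₁) ⟩
    0ℚ + w₁         ≡⟨ cong (_+ w₁) (sym w₀≡0) ⟩
    w₀ + w₁         ≡⟨ w₀+w₁≡0 ⟩
    0ℚ              ∎))

sum-and-difference-injective : ∀ {s c s′ c′} → s ℕ.+ c ≡ s′ ℕ.+ c′ →
  fromℕ s - fromℕ c ≡ fromℕ s′ - fromℕ c′ → s ≡ s′ × c ≡ c′
sum-and-difference-injective {s} {c} {s′} {c′} sum≡ difference≡ =
  s≡s′ , ℕP.+-cancelˡ-≡ s′ c c′ (trans (cong (ℕ._+ c) (sym s≡s′)) sum≡)
  where
  open ≡-Reasoning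
  double : ∀ s c → fromℕ (s ℕ.+ s) ≡ fromℕ (s ℕ.+ c) + (fromℕ s - fromℕ c)
  double s c = begin
    fromℕ (s ℕ.+ s)                      ≡⟨ fromℕ-+ s s ⟩
    fromℕ s + fromℕ s                    ≡⟨ identity (fromℕ s) (fromℕ c) ⟩
    (fromℕ s + fromℕ c) + (fromℕ s - fromℕ c)
      ≡⟨ cong (_+ (fromℕ s - fromℕ c)) (sym (fromℕ-+ s c)) ⟩
    fromℕ (s ℕ.+ c) + (fromℕ s - fromℕ c) ∎
    where
    identity : ∀ s c → s + s ≡ (s + c) + (s - c)
    identity = solve 2 (λ s c → s :+ s := (s :+ c) :+ (s :- c)) refl
  fromℕ-doubles : fromℕ (s ℕ.+ s) ≡ fromℕ (s′ ℕ.+ s′)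
  fromℕ-doubles = begin
    fromℕ (s ℕ.+ s)                          ≡⟨ double s c ⟩
    fromℕ (s ℕ.+ c) + (fromℕ s - fromℕ c)    ≡⟨ cong₂ _+_ (cong fromℕ sum≡) difference≡ ⟩
    fromℕ (s′ ℕ.+ c′) + (fromℕ s′ - fromℕ c′) ≡⟨ double s′ c′ ⟨
    fromℕ (s′ ℕ.+ s′)                        ∎
  s≡s′ : s ≡ s′
  s≡s′ = ℕP.*-cancelˡ-≡ s s′ 2 (begin
    2 ℕ.* s     ≡⟨ cong (s ℕ.+_) (ℕP.+-identityʳ s) ⟩
    s ℕ.+ s     ≡⟨ fromℕ-injective fromℕ-doubles ⟩
    s′ ℕ.+ s′   ≡⟨ cong (s′ ℕ.+_) (sym (ℕP.+-identityʳ s′)) ⟩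
    2 ℕ.* s′    ∎)

θ<sum : ∀ {θ a b k} → a ℕ.+ b ≡ k → θ ℚ.< fromℕ k → θ ℚ.< fromℕ a + fromℕ b
θ<sum {θ} {a} {b} a+b≡k = subst (θ ℚ.<_) (trans (cong fromℕ (sym a+b≡k)) (fromℕ-+ a b))

difference<sum⇒≢0 : ∀ {θ a b} → θ ≡ fromℕ a - fromℕ b → θ ℚ.< fromℕ a + fromℕ b → b ≢ 0
difference<sum⇒≢0 {θ} {a} {b} θ≡a-b θ<a+b b≡0 = ℚP.<⇒≢ θ<a+b (begin
  θ                   ≡⟨ θ≡a-b ⟩
  fromℕ a - fromℕ b   ≡⟨ cong (λ t → fromℕ a - t) fromℕb≡0 ⟩
  fromℕ a + 0ℚ        ≡⟨ cong (λ t → fromℕ a + t) (sym fromℕb≡0) ⟩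
  fromℕ a + fromℕ b   ∎)
  where
  open ≡-Reasoning
  fromℕb≡0 : fromℕ b ≡ 0ℚ
  fromℕb≡0 = trans (cong fromℕ b≡0) fromℕ-0

∧-true⁻ : ∀ {a b} → a ∧ b ≡ true → a ≡ true × b ≡ true
∧-true⁻ {true} b≡true = refl , b≡true

∧-true⁺ : ∀ {a b} → a ≡ true → b ≡ true → a ∧ b ≡ true
∧-true⁺ refl b≡true = b≡true

∨-trueˡ : ∀ {a} b → a ≡ true → a ∨ b ≡ true
∨-trueˡ b refl = refl

∨-trueʳ : ∀ a {b} → b ≡ true → a ∨ b ≡ true
∨-trueʳ false b≡true = b≡true
∨-trueʳ true  _      = refl

not-true : ∀ {a} → not a ≡ true → a ≡ false
not-true {false} _ = refl

xor-true : ∀ a {b} → a xor b ≡ true → b ≡ not a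
xor-true true  {false} _ = refl
xor-true false {true}  _ = refl

≟-true : ∀ {n} {x y : Fin n} → does (x Fin.≟ y) ≡ true → x ≡ y
≟-true {x = x} {y} e with x Fin.≟ y
... | yes x≡y = x≡y

anyF-intro : ∀ {n} (p : Fin n → Bool) x → p x ≡ true → anyF p ≡ true
anyF-intro p Fin.zero    px≡true = ∨-trueˡ _ px≡true
anyF-intro p (Fin.suc x) px≡true = ∨-trueʳ (p Fin.zero) (anyF-intro (p ∘ Fin.suc) x px≡true)

anyF-elim : ∀ {n} (p : Fin n → Bool) → anyF p ≡ true → ∃ λ x → p x ≡ true
anyF-elim {suc n} p e with p Fin.zero in p0
... | true  = Fin.zero , p0
... | false = let x , px = anyF-elim (p ∘ Fin.suc) e in Fin.suc x , px

anyF-only : ∀ {n} (p : Fin n → Bool) x → (∀ y → p y ≡ true → y ≡ x) → anyF p ≡ p x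
anyF-only p x only-x with anyF p in any-p | p x in px
... | false | false = refl
... | true  | true  = refl
... | false | true  = trans (sym any-p) (anyF-intro p x px)
... | true  | false with anyF-elim p any-p
...   | y , py with only-x y py
...     | refl = trans (sym py) px

cnt-cong : ∀ {n} {p q : Fin n → Bool} → (∀ z → p z ≡ q z) → cnt p ≡ cnt q
cnt-cong p≗q = cong Data.Fin.Subset.∣_∣ (tabulate-cong p≗q)

cnt-false : ∀ {n} → cnt {n} (const false) ≡ 0
cnt-false {zero}  = refl
cnt-false {suc n} = cnt-false {n}

cnt-split : ∀ {n} (p r : Fin n → Bool) →
  cnt (λ z → p z ∧ r z) ℕ.+ cnt (λ z → p z ∧ not (r z)) ≡ cnt p
cnt-split {zero} p r = refl
cnt-split {suc n} p r
  with p Fin.zero | r Fin.zero | cnt-split (p ∘ Fin.suc) (r ∘ Fin.suc)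
... | true  | true  | ih = cong suc ih
... | true  | false | ih = trans (ℕP.+-suc _ _) (cong suc ih)
... | false | _     | ih = ih

cnt≢0⇒witness : ∀ {n} (p : Fin n → Bool) → cnt p ≢ 0 → ∃ λ z → p z ≡ true
cnt≢0⇒witness {zero} p cnt≢0 = ⊥-elim (cnt≢0 refl)
cnt≢0⇒witness {suc n} p cnt≢0 with p Fin.zero in p0
... | true  = Fin.zero , p0
... | false = let z , pz = cnt≢0⇒witness (p ∘ Fin.suc) cnt≢0 in Fin.suc z , pz

sumF-cong : ∀ {n} {f g : Fin n → ℚ} → (∀ z → f z ≡ g z) → sumF f ≡ sumF g
sumF-cong {zero}  f≗g = refl
sumF-cong {suc n} f≗g = cong₂ _+_ (f≗g Fin.zero) (sumF-cong (f≗g ∘ Fin.suc))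

sumF-neg : ∀ {n} (f : Fin n → ℚ) → sumF (λ z → - f z) ≡ - sumF f
sumF-neg {zero}  f = refl
sumF-neg {suc n} f =
  trans (cong (λ t → - f Fin.zero + t) (sumF-neg (f ∘ Fin.suc)))
        (sym (ℚP.neg-distrib-+ (f Fin.zero) (sumF (f ∘ Fin.suc))))

sumF≤cnt* : ∀ {n} (p : Fin n → Bool) (v : Fin n → ℚ) {M} → 0ℚ ℚ.≤ M → (∀ z → v z ℚ.≤ M) →
  sumF (λ z → if p z then v z else 0ℚ) ℚ.≤ fromℕ (cnt p) * M
sumF≤cnt* {zero} p v {M} _ _ = ℚP.≤-reflexive (sym (trans (cong (_* M) fromℕ-0) (ℚP.*-zeroˡ M)))
sumF≤cnt* {suc n} p v {M} 0≤M v≤M with p Fin.zero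
... | true  = begin
  v Fin.zero + rest              ≤⟨ ℚP.+-mono-≤ (v≤M Fin.zero) ih ⟩
  M + fromℕ c * M                ≡⟨ distrib M (fromℕ c) ⟩
  (1ℚ + fromℕ c) * M             ≡⟨ cong (_* M) (sym (fromℕ-suc c)) ⟩
  fromℕ (suc c) * M              ∎
  where
  open ℚP.≤-Reasoning
  rest = sumF (λ z → if p (Fin.suc z) then v (Fin.suc z) else 0ℚ)
  c = cnt (p ∘ Fin.suc)
  ih = sumF≤cnt* (p ∘ Fin.suc) (v ∘ Fin.suc) 0≤M (v≤M ∘ Fin.suc)
  distrib : ∀ M c → M + c * M ≡ (1ℚ + c) * M
  distrib = solve 2 (λ M c → M :+ c :* M := (con 1ℚ :+ c) :* M) refl
... | false = ℚP.≤-trans (ℚP.≤-reflexive (ℚP.+-identityˡ _))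
                (sumF≤cnt* (p ∘ Fin.suc) (v ∘ Fin.suc) 0≤M (v≤M ∘ Fin.suc))

sign : Bool → ℤ
sign true  = + 1
sign false = -[1+ 0 ]

sumF-signs : ∀ {n} (p r : Fin n → Bool) →
  sumF (λ z → if p z then sign (r z) / 1 else 0ℚ) ≡
  fromℕ (cnt (λ z → p z ∧ r z)) - fromℕ (cnt (λ z → p z ∧ not (r z)))
sumF-signs {zero} p r = sym (cong₂ _-_ fromℕ-0 fromℕ-0)
sumF-signs {suc n} p r with p Fin.zero | r Fin.zero | sumF-signs (p ∘ Fin.suc) (r ∘ Fin.suc)
... | true  | true  | ih = trans (cong (λ q → 1ℚ + q) ih) (1+difference _ _)
... | true  | false | ih = trans (cong (λ q → - 1ℚ + q) ih) (-1+difference _ _)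
... | false | _     | ih = trans (ℚP.+-identityˡ _) ih

≤maxF : ∀ {n} (f : Fin n → ℕ) x → f x ≤ maxF f
≤maxF f Fin.zero    = ℕP.m≤m⊔n _ _
≤maxF f (Fin.suc x) = ℕP.≤-trans (≤maxF (f ∘ Fin.suc) x) (ℕP.m≤n⊔m _ _)

maxF≤ : ∀ {n} (f : Fin n → ℕ) {b} → (∀ x → f x ≤ b) → maxF f ≤ b
maxF≤ {zero}  f _    = z≤n
maxF≤ {suc n} f f≤b = ℕP.⊔-lub (f≤b Fin.zero) (maxF≤ (f ∘ Fin.suc) (f≤b ∘ Fin.suc))

∣sign∣≡1 : ∀ b → ℤ.∣ sign b ∣ ≡ 1
∣sign∣≡1 true  = refl
∣sign∣≡1 false = refl

sign≢0 : ∀ b → sign b ≢ ℤ.0ℤ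
sign≢0 true  ()
sign≢0 false ()

nonNegative : ℤ → Bool
nonNegative (+ _)    = true
nonNegative -[1+ _ ] = false

unit≡sign : ∀ i → i ≢ ℤ.0ℤ → ℤ.∣ i ∣ ≤ 1 → i ≡ sign (nonNegative i)
unit≡sign (+ zero)          i≢0 _ = ⊥-elim (i≢0 refl)
unit≡sign (+ suc zero)      _   _ = refl
unit≡sign -[1+ zero ]       _   _ = refl
unit≡sign (+ suc (suc _))   _   (s≤s ())
unit≡sign -[1+ suc _ ]      _   (s≤s ())

sign-cancel : ∀ b {q θ} → (sign b / 1) * q ≡ θ * (sign b / 1) → q ≡ θ
sign-cancel true {q} {θ} e = trans (sym (ℚP.*-identityˡ q)) (trans e (ℚP.*-identityʳ θ))
sign-cancel false {q} {θ} e = begin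
  q                          ≡⟨ neg-neg q ⟩
  - 1ℚ * (- 1ℚ * q)          ≡⟨ cong (- 1ℚ *_) e ⟩
  - 1ℚ * (θ * - 1ℚ)          ≡⟨ neg-neg′ θ ⟩
  θ                          ∎
  where
  open ≡-Reasoning
  neg-neg : ∀ q → q ≡ - 1ℚ * (- 1ℚ * q)
  neg-neg = solve 1 (λ q → q := :- con 1ℚ :* (:- con 1ℚ :* q)) refl
  neg-neg′ : ∀ θ → - 1ℚ * (θ * - 1ℚ) ≡ θ
  neg-neg′ = solve 1 (λ θ → :- con 1ℚ :* (θ :* :- con 1ℚ) := θ) refl

atZero : ℕ → ℕ → ℕ
atZero b zero    = b
atZero b (suc _) = 0

bipartition-codeEigenvalue : ∀ a b →
  CodeEigenvalue 1 (const a) (atZero b) (const b) (fromℕ a - fromℕ b)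
bipartition-codeEigenvalue a b = w , (Fin.zero , λ ()) , rows
  where
  w : Fin 2 → ℚ
  w Fin.zero           = 1ℚ
  w (Fin.suc Fin.zero) = - 1ℚ
  row₀ : ∀ a b → a * 1ℚ + (b * - 1ℚ + 0ℚ) ≡ (a - b) * 1ℚ
  row₀ = solve 2 (λ a b → a :* con 1ℚ :+ (b :* :- con 1ℚ :+ con 0ℚ) := (a :- b) :* con 1ℚ) refl
  row₁ : ∀ a b → b * 1ℚ + (a * - 1ℚ + 0ℚ) ≡ (a - b) * - 1ℚ
  row₁ = solve 2 (λ a b → b :* con 1ℚ :+ (a :* :- con 1ℚ :+ con 0ℚ) := (a :- b) :* :- con 1ℚ) refl
  rows : ∀ j → sumF (λ l → tridiag 1 (const a) (atZero b) (const b) j l * w l) ≡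
    (fromℕ a - fromℕ b) * w j
  rows Fin.zero = subst₂ (λ x y → x * 1ℚ + (y * - 1ℚ + 0ℚ) ≡ (fromℕ a - fromℕ b) * 1ℚ)
    (fromℕ≡/1 a) (fromℕ≡/1 b) (row₀ (fromℕ a) (fromℕ b))
  rows (Fin.suc Fin.zero) =
    subst₂ (λ x y → y * 1ℚ + (x * - 1ℚ + 0ℚ) ≡ (fromℕ a - fromℕ b) * - 1ℚ)
    (fromℕ≡/1 a) (fromℕ≡/1 b) (row₁ (fromℕ a) (fromℕ b))

tridiag-eigenvalue : ∀ {α β γ θ} → CodeEigenvalue 1 α β γ θ → α 1 ≡ α 0 → γ 1 ≡ β 0 →
  θ ≢ fromℕ (α 0) + fromℕ (β 0) → θ ≡ fromℕ (α 0) - fromℕ (β 0)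
tridiag-eigenvalue {α} {β} {γ} {θ} (w , (j , wj≢0) , rows) α₁≡α₀ γ₁≡β₀ =
  symmetric-eigenvalue (fromℕ (α 0)) (fromℕ (β 0)) row₀ row₁ (w≢0 j wj≢0)
  where
  w₀ w₁ : ℚ
  w₀ = w Fin.zero
  w₁ = w (Fin.suc Fin.zero)
  row₀ : fromℕ (α 0) * w₀ + (fromℕ (β 0) * w₁ + 0ℚ) ≡ θ * w₀
  row₀ = subst₂ (λ x y → x * w₀ + (y * w₁ + 0ℚ) ≡ θ * w₀)
    (sym (fromℕ≡/1 (α 0))) (sym (fromℕ≡/1 (β 0))) (rows Fin.zero)
  row₁ : fromℕ (β 0) * w₀ + (fromℕ (α 0) * w₁ + 0ℚ) ≡ θ * w₁
  row₁ = subst₂ (λ x y → x * w₀ + (y * w₁ + 0ℚ) ≡ θ * w₁)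
    (trans (sym (fromℕ≡/1 (γ 1))) (cong fromℕ γ₁≡β₀))
    (trans (sym (fromℕ≡/1 (α 1))) (cong fromℕ α₁≡α₀))
    (rows (Fin.suc Fin.zero))
  w≢0 : ∀ j → w j ≢ 0ℚ → ¬ (w₀ ≡ 0ℚ × w₁ ≡ 0ℚ)
  w≢0 Fin.zero           w₀≢0 (w₀≡0 , _)   = w₀≢0 w₀≡0
  w≢0 (Fin.suc Fin.zero) w₁≢0 (_ , w₁≡0)   = w₁≢0 w₁≡0

module _ {n : ℕ} (G : Graph n) where

  applyA-cong : ∀ {v w} → (∀ y → v y ≡ w y) → ∀ x → applyA G v x ≡ applyA G w x
  applyA-cong v≗w x = sumF-cong (λ y → cong (if adj G x y then_else 0ℚ) (v≗w y))

  applyA-neg : ∀ v x → applyA G (λ y → - v y) x ≡ - applyA G v x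
  applyA-neg v x =
    trans (sumF-cong (λ y → if-neg (adj G x y) (v y)))
          (sumF-neg (λ y → if adj G x y then v y else 0ℚ))
    where
    if-neg : ∀ b q → (if b then - q else 0ℚ) ≡ - (if b then q else 0ℚ)
    if-neg true  q = refl
    if-neg false q = refl

  -- At a vertex m where v is largest, θ v(m) = Σ_{z ~ m} v(z) ≤ k v(m).
  eigenvalue≤degree⁺ : ∀ {k v θ x₀} → Regular G k → (∀ x → applyA G v x ≡ θ * v x) →
    0ℚ ℚ.< v x₀ → θ ℚ.≤ fromℕ k
  eigenvalue≤degree⁺ {k} {v} {θ} {x₀} reg eig 0<vx₀ =
    ℚP.*-cancelʳ-≤-pos (v m) {{ℚ.positive 0<vm}} (begin
      θ * v m                      ≡⟨ sym (eig m) ⟩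
      applyA G v m                 ≤⟨ sumF≤cnt* (adj G m) v (ℚP.<⇒≤ 0<vm) v≤vm ⟩
      fromℕ (cnt (adj G m)) * v m  ≡⟨ cong (λ d → fromℕ d * v m) (reg m) ⟩
      fromℕ k * v m                ∎)
    where
    open ℚP.≤-Reasoning
    m : Fin n
    m = argmax v x₀ (allFin n)
    v≤vm : ∀ y → v y ℚ.≤ v m
    v≤vm y = All.lookup (f[xs]≤f[argmax] {f = v} x₀ (allFin n)) (∈-allFin y)
    0<vm : 0ℚ ℚ.< v m
    0<vm = ℚP.<-≤-trans 0<vx₀ (f[⊥]≤f[argmax] {f = v} x₀ (allFin n))

  eigenvalue≤degree : ∀ {k v θ x₀} → Regular G k → (∀ x → applyA G v x ≡ θ * v x) →
    v x₀ ≢ 0ℚ → θ ℚ.≤ fromℕ k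
  eigenvalue≤degree {k} {v} {θ} {x₀} reg eig vx₀≢0 with ℚP.<-cmp 0ℚ (v x₀)
  ... | tri< 0<vx₀ _ _ = eigenvalue≤degree⁺ reg eig 0<vx₀
  ... | tri≈ _ 0≡vx₀ _ = ⊥-elim (vx₀≢0 (sym 0≡vx₀))
  ... | tri> _ _ vx₀<0 = eigenvalue≤degree⁺ reg eig⁻ (ℚP.neg-antimono-< vx₀<0)
    where
    eig⁻ : ∀ x → applyA G (λ y → - v y) x ≡ θ * - v x
    eig⁻ x = trans (applyA-neg v x) (trans (cong -_ (eig x)) (ℚP.neg-distribʳ-* θ (v x)))

  degIn : (Fin n → Bool) → Fin n → ℕ
  degIn Q x = cnt (λ z → adj G x z ∧ Q z)

  degIn-cong : ∀ {Q R} → (∀ z → Q z ≡ R z) → ∀ x → degIn Q x ≡ degIn R x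
  degIn-cong Q≗R x = cnt-cong (λ z → cong (adj G x z ∧_) (Q≗R z))

  degIn-empty : ∀ x → degIn (const false) x ≡ 0
  degIn-empty x = trans (cnt-cong (λ z → ∧-zeroʳ (adj G x z))) (cnt-false {n})

  sameDeg crossDeg : (Fin n → Bool) → Fin n → ℕ
  sameDeg  P x = degIn (λ z → not (P x xor P z)) x
  crossDeg P x = degIn (λ z → P x xor P z) x

  sameDeg+crossDeg : ∀ {k} → Regular G k → ∀ P x → sameDeg P x ℕ.+ crossDeg P x ≡ k
  sameDeg+crossDeg reg P x =
    trans (ℕP.+-comm (sameDeg P x) _) (trans (cnt-split (adj G x) (λ z → P x xor P z)) (reg x))

  degrees-inside : ∀ P x → P x ≡ true →
    sameDeg P x ≡ degIn P x × crossDeg P x ≡ degIn (not ∘ P) x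
  degrees-inside P x Px≡true =
    degIn-cong (λ z → trans (cong (λ b → not (b xor P z)) Px≡true) (not-involutive (P z))) x ,
    degIn-cong (λ z → cong (_xor P z) Px≡true) x

  degrees-outside : ∀ P x → P x ≡ false →
    sameDeg P x ≡ degIn (not ∘ P) x × crossDeg P x ≡ degIn P x
  degrees-outside P x Px≡false =
    degIn-cong (λ z → cong (λ b → not (b xor P z)) Px≡false) x ,
    degIn-cong (λ z → cong (_xor P z) Px≡false) x

  crossNeighbour : ∀ P x → crossDeg P x ≢ 0 → ∃ λ z → adj G x z ≡ true × P z ≡ not (P x)
  crossNeighbour P x cross≢0 =
    let z , adj∧cross = cnt≢0⇒witness (λ z → adj G x z ∧ (P x xor P z)) cross≢0
        xz , crosses = ∧-true⁻ adj∧cross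
    in z , xz , xor-true (P x) crosses

  applyA-sign : ∀ P x → applyA G (λ y → sign (P y) / 1) x ≡
    (sign (P x) / 1) * (fromℕ (sameDeg P x) - fromℕ (crossDeg P x))
  applyA-sign P x = trans (sumF-signs (adj G x) P) (bySide (P x) refl)
    where
    bySide : ∀ b → P x ≡ b → fromℕ (degIn P x) - fromℕ (degIn (not ∘ P) x) ≡
      (sign b / 1) * (fromℕ (sameDeg P x) - fromℕ (crossDeg P x))
    bySide true Px≡true
      rewrite proj₁ (degrees-inside P x Px≡true) | proj₂ (degrees-inside P x Px≡true) =
      sym (ℚP.*-identityˡ _)
    bySide false Px≡false
      rewrite proj₁ (degrees-outside P x Px≡false) | proj₂ (degrees-outside P x Px≡false) =
      swap (fromℕ (degIn P x)) (fromℕ (degIn (not ∘ P) x))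
      where
      swap : ∀ c s → c - s ≡ - 1ℚ * (s - c)
      swap = solve 2 (λ c s → c :- s := :- con 1ℚ :* (s :- c)) refl

  SignEigenvector : (Fin n → Bool) → ℚ → Set
  SignEigenvector P θ = ∀ x → applyA G (λ y → sign (P y) / 1) x ≡ θ * (sign (P x) / 1)

  sign-eigenvector⇒difference : ∀ P {θ} → SignEigenvector P θ →
    ∀ x → fromℕ (sameDeg P x) - fromℕ (crossDeg P x) ≡ θ
  sign-eigenvector⇒difference P eig x = sign-cancel (P x) (trans (sym (applyA-sign P x)) (eig x))

  EquitableBipartition : (Fin n → Bool) → ℕ → ℕ → Set
  EquitableBipartition P a b = ∀ x → sameDeg P x ≡ a × crossDeg P x ≡ b

  sign-eigenvector⇒equitable : ∀ {k θ} P → Regular G k → SignEigenvector P θ →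
    ∀ x₀ → EquitableBipartition P (sameDeg P x₀) (crossDeg P x₀)
  sign-eigenvector⇒equitable {θ = θ} P reg eig x₀ x = sum-and-difference-injective
    (trans (sameDeg+crossDeg reg P x) (sym (sameDeg+crossDeg reg P x₀)))
    (trans (difference x) (sym (difference x₀)))
    where
    difference : ∀ x → fromℕ (sameDeg P x) - fromℕ (crossDeg P x) ≡ θ
    difference = sign-eigenvector⇒difference P eig

  equitable⇒sign-eigenvector : ∀ P {a b} → EquitableBipartition P a b →
    SignEigenvector P (fromℕ a - fromℕ b)
  equitable⇒sign-eigenvector P {a} {b} equitable x
    rewrite applyA-sign P x | proj₁ (equitable x) | proj₂ (equitable x) =
    ℚP.*-comm (sign (P x) / 1) (fromℕ a - fromℕ b)

  equitable-degree : ∀ {k a b} P → Regular G k → EquitableBipartition P a b → Fin n →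
    a ℕ.+ b ≡ k
  equitable-degree P reg equitable x =
    trans (sym (cong₂ ℕ._+_ (proj₁ (equitable x)) (proj₂ (equitable x)))) (sameDeg+crossDeg reg P x)

  within-refl : ∀ k x → within G k x x ≡ true
  within-refl zero    x = dec-true (x Fin.≟ x) refl
  within-refl (suc k) x = ∨-trueˡ _ (within-refl k x)

  walk₁≡adj : ∀ x y → walk G 1 x y ≡ adj G x y
  walk₁≡adj x y = begin
    walk G 1 x y                        ≡⟨ anyF-only _ y (λ z e → ≟-true (proj₂ (∧-true⁻ e))) ⟩
    adj G x y ∧ does (y Fin.≟ y)        ≡⟨ cong (adj G x y ∧_) (dec-true (y Fin.≟ y) refl) ⟩
    adj G x y ∧ true                    ≡⟨ ∧-identityʳ (adj G x y) ⟩
    adj G x y                           ∎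
    where open ≡-Reasoning

  distIs⇒within : ∀ i x y → distIs G i x y ≡ true → within G i x y ≡ true
  distIs⇒within zero    x y d = d
  distIs⇒within (suc i) x y d = proj₁ (∧-true⁻ d)

  withinSet₀ : ∀ C x → withinSet G C 0 x ≡ lookup C x
  withinSet₀ C x = begin
    withinSet G C 0 x                   ≡⟨ anyF-only _ x (λ c e → sym (≟-true (proj₂ (∧-true⁻ e)))) ⟩
    lookup C x ∧ does (x Fin.≟ x)       ≡⟨ cong (lookup C x ∧_) (dec-true (x Fin.≟ x) refl) ⟩
    lookup C x ∧ true                   ≡⟨ ∧-identityʳ (lookup C x) ⟩
    lookup C x                          ∎
    where open ≡-Reasoning

  withinSet-member : ∀ C k {c} x → lookup C c ≡ true → within G k x c ≡ true →
    withinSet G C k x ≡ true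
  withinSet-member C k {c} x c∈C xc = anyF-intro _ c (∧-true⁺ c∈C xc)

  withinSet-witness : ∀ C k x → withinSet G C k x ≡ true →
    ∃ λ c → lookup C c ≡ true × within G k x c ≡ true
  withinSet-witness C k x e =
    let c , c∈C∧xc = anyF-elim (λ c → lookup C c ∧ within G k x c) e
    in c , ∧-true⁻ {lookup C c} c∈C∧xc

  withinSet-suc : ∀ C k x → withinSet G C k x ≡ true → withinSet G C (suc k) x ≡ true
  withinSet-suc C k x e =
    let c , c∈C , xc = withinSet-witness C k x e
    in withinSet-member C (suc k) x c∈C (∨-trueˡ (walk G (suc k) x c) xc)

  inLayer-least : ∀ C i x → withinSet G C i x ≡ true → ∃ λ j → j ≤ i × inLayer G C j x ≡ true
  inLayer-least C zero    x e = 0 , z≤n , e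
  inLayer-least C (suc i) x e with withinSet G C i x in earlier
  ... | true  = let j , j≤i , layer = inLayer-least C i x earlier in j , ℕP.m≤n⇒m≤1+n j≤i , layer
  ... | false = suc i , ℕP.≤-refl , ∧-true⁺ e (cong not earlier)

  inLayer₀-tabulate : ∀ P x → inLayer G (tabulate P) 0 x ≡ P x
  inLayer₀-tabulate P x = trans (withinSet₀ (tabulate P) x) (lookup∘tabulate P x)

  module TabulateLayers (P : Fin n → Bool)
    (crossing : ∀ x → ∃ λ z → adj G x z ≡ true × P z ≡ not (P x)) where

    withinSet₁-tabulate : ∀ x → withinSet G (tabulate P) 1 x ≡ true
    withinSet₁-tabulate x with P x in Px
    ... | true  = withinSet-member (tabulate P) 1 x (trans (lookup∘tabulate P x) Px) (within-refl 1 x)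
    ... | false =
      let z , xz , Pz = crossing x
      in withinSet-member (tabulate P) 1 x (trans (lookup∘tabulate P z) (trans Pz (cong not Px)))
           (∨-trueʳ (within G 0 x z) (trans (walk₁≡adj x z) xz))

    withinSet-tabulate : ∀ k x → withinSet G (tabulate P) (suc k) x ≡ true
    withinSet-tabulate zero    x = withinSet₁-tabulate x
    withinSet-tabulate (suc k) x = withinSet-suc (tabulate P) (suc k) x (withinSet-tabulate k x)

    inLayer₁-tabulate : ∀ x → inLayer G (tabulate P) 1 x ≡ not (P x)
    inLayer₁-tabulate x =
      cong₂ (λ a b → a ∧ not b) (withinSet-tabulate 0 x) (inLayer₀-tabulate P x)

    inLayer₂₊-tabulate : ∀ j x → inLayer G (tabulate P) (2 ℕ.+ j) x ≡ false
    inLayer₂₊-tabulate j x =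
      cong₂ (λ a b → a ∧ not b) (withinSet-tabulate (suc j) x) (withinSet-tabulate j x)

    inLayer₁-inhabited : Fin n → ∃ λ x → inLayer G (tabulate P) 1 x ≡ true
    inLayer₁-inhabited x₀ with P x₀ in Px₀
    ... | false = x₀ , trans (inLayer₁-tabulate x₀) (cong not Px₀)
    ... | true  =
      let z , _ , Pz = crossing x₀
      in z , trans (inLayer₁-tabulate z) (cong not (trans Pz (cong not Px₀)))

    degIn-inLayer₀ : ∀ x → degIn (inLayer G (tabulate P) 0) x ≡ degIn P x
    degIn-inLayer₀ = degIn-cong (inLayer₀-tabulate P)

    degIn-inLayer₁ : ∀ x → degIn (inLayer G (tabulate P) 1) x ≡ degIn (not ∘ P) x
    degIn-inLayer₁ = degIn-cong inLayer₁-tabulate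

    degIn-inLayer₂ : ∀ x → degIn (inLayer G (tabulate P) 2) x ≡ 0
    degIn-inLayer₂ x = trans (degIn-cong (inLayer₂₊-tabulate 0) x) (degIn-empty x)

  equitable⇒completelyRegular : ∀ P {a b} → EquitableBipartition P a b → b ≢ 0 → Fin n →
    CompletelyRegular G (tabulate P) 1 (const a) (atZero b) (const b)
  equitable⇒completelyRegular P {a} {b} equitable b≢0 x₀ =
    inLayer₁-inhabited x₀ , beyond-1 , inner , outer
    where
    crossing : ∀ x → ∃ λ z → adj G x z ≡ true × P z ≡ not (P x)
    crossing x = crossNeighbour P x (λ cross≡0 → b≢0 (trans (sym (proj₂ (equitable x))) cross≡0))
    open TabulateLayers P crossing
    C : Subset n
    C = tabulate P

    beyond-1 : ∀ j x → 1 < j → inLayer G C j x ≡ false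
    beyond-1 (suc (suc j)) x _ = inLayer₂₊-tabulate j x
    beyond-1 (suc zero)    x (s≤s ())

    inner : ∀ i x → i ≤ 1 → inLayer G C i x ≡ true →
      degIn (inLayer G C i) x ≡ a × degIn (inLayer G C (suc i)) x ≡ atZero b i
    inner zero x _ x∈C =
      let same , cross = degrees-inside P x (trans (sym (inLayer₀-tabulate P x)) x∈C)
      in trans (degIn-inLayer₀ x) (trans (sym same) (proj₁ (equitable x))) ,
         trans (degIn-inLayer₁ x) (trans (sym cross) (proj₂ (equitable x)))
    inner (suc zero) x _ x∈L₁ =
      let same , _ = degrees-outside P x (not-true (trans (sym (inLayer₁-tabulate x)) x∈L₁))
      in trans (degIn-inLayer₁ x) (trans (sym same) (proj₁ (equitable x))) , degIn-inLayer₂ x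
    inner (suc (suc i)) x (s≤s ()) _

    outer : ∀ i x → suc i ≤ 1 → inLayer G C (suc i) x ≡ true → degIn (inLayer G C i) x ≡ b
    outer zero x _ x∈L₁ =
      let _ , cross = degrees-outside P x (not-true (trans (sym (inLayer₁-tabulate x)) x∈L₁))
      in trans (degIn-inLayer₀ x) (trans (sym cross) (proj₂ (equitable x)))
    outer (suc i) x (s≤s ()) _

  module CoveringRadiusOne {C : Subset n} {α β γ : ℕ → ℕ}
    (connected : Connected G) (cr : CompletelyRegular G C 1 α β γ) where

    private
      x₁ : Fin n
      x₁ = proj₁ (proj₁ cr)

      x₁∈L₁ : inLayer G C 1 x₁ ≡ true
      x₁∈L₁ = proj₂ (proj₁ cr)

      x₁∉C : inLayer G C 0 x₁ ≡ false
      x₁∉C = not-true (proj₂ (∧-true⁻ {withinSet G C 1 x₁} x₁∈L₁))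

      c : Fin n
      c = proj₁ (withinSet-witness C 1 x₁ (proj₁ (∧-true⁻ x₁∈L₁)))

      c∈C : lookup C c ≡ true
      c∈C = proj₁ (proj₂ (withinSet-witness C 1 x₁ (proj₁ (∧-true⁻ x₁∈L₁))))

      beyond : ∀ j x → 1 < j → inLayer G C j x ≡ false
      beyond = proj₁ (proj₂ cr)

      inner : ∀ i x → i ≤ 1 → inLayer G C i x ≡ true →
        degIn (inLayer G C i) x ≡ α i × degIn (inLayer G C (suc i)) x ≡ β i
      inner = proj₁ (proj₂ (proj₂ cr))

      outer : ∀ i x → suc i ≤ 1 → inLayer G C (suc i) x ≡ true →
        degIn (inLayer G C i) x ≡ γ (suc i)
      outer = proj₂ (proj₂ (proj₂ cr))

    inLayer₁≡not-inLayer₀ : ∀ x → inLayer G C 1 x ≡ not (inLayer G C 0 x)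
    inLayer₁≡not-inLayer₀ x with connected x c
    ... | i , dist with inLayer-least C i x (withinSet-member C i x c∈C (distIs⇒within i x c dist))
    ...   | zero , _ , x∈C =
      trans (cong (λ b → withinSet G C 1 x ∧ not b) x∈C) (trans (∧-zeroʳ _) (cong not (sym x∈C)))
    ...   | suc zero , _ , x∈L₁ = trans x∈L₁ (sym (cong not (not-true (proj₂ (∧-true⁻ x∈L₁)))))
    ...   | suc (suc j) , _ , x∈L with trans (sym (beyond (suc (suc j)) x (s≤s (s≤s z≤n)))) x∈L
    ...     | ()

    private
      degIn-L₁ : ∀ x → degIn (inLayer G C 1) x ≡ degIn (not ∘ inLayer G C 0) x
      degIn-L₁ = degIn-cong inLayer₁≡not-inLayer₀

      inside-degrees : ∀ x → inLayer G C 0 x ≡ true →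
        sameDeg (inLayer G C 0) x ≡ α 0 × crossDeg (inLayer G C 0) x ≡ β 0
      inside-degrees x x∈C =
        let same , cross = degrees-inside (inLayer G C 0) x x∈C
            αx , βx = inner 0 x z≤n x∈C
        in trans same αx , trans cross (trans (sym (degIn-L₁ x)) βx)

      outside-degrees : ∀ x → inLayer G C 0 x ≡ false →
        sameDeg (inLayer G C 0) x ≡ α 1 × crossDeg (inLayer G C 0) x ≡ γ 1
      outside-degrees x x∉C =
        let same , cross = degrees-outside (inLayer G C 0) x x∉C
            x∈L₁ = trans (inLayer₁≡not-inLayer₀ x) (cong not x∉C)
        in trans same (trans (sym (degIn-L₁ x)) (proj₁ (inner 1 x ℕP.≤-refl x∈L₁))) ,
           trans cross (outer 0 x ℕP.≤-refl x∈L₁)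

    α₁≡α₀ : ∀ {k} → Regular G k → γ 1 ≡ β 0 → α 1 ≡ α 0
    α₁≡α₀ {k} reg γ₁≡β₀ = ℕP.+-cancelʳ-≡ (β 0) (α 1) (α 0) (begin
      α 1 ℕ.+ β 0   ≡⟨ cong (α 1 ℕ.+_) (sym γ₁≡β₀) ⟩
      α 1 ℕ.+ γ 1   ≡⟨ degree-sum x₁ (outside-degrees x₁ x₁∉C) ⟩
      k             ≡⟨ sym (degree-sum c (inside-degrees c c∈L₀)) ⟩
      α 0 ℕ.+ β 0   ∎)
      where
      open ≡-Reasoning
      c∈L₀ : inLayer G C 0 c ≡ true
      c∈L₀ = withinSet-member C 0 c c∈C (within-refl 0 c)
      degree-sum : ∀ x {s t} → sameDeg (inLayer G C 0) x ≡ s × crossDeg (inLayer G C 0) x ≡ t →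
        s ℕ.+ t ≡ k
      degree-sum x (same , cross) =
        trans (sym (cong₂ ℕ._+_ same cross)) (sameDeg+crossDeg reg (inLayer G C 0) x)

    completelyRegular⇒equitable : ∀ {k} → Regular G k → γ 1 ≡ β 0 →
      EquitableBipartition (inLayer G C 0) (α 0) (β 0)
    completelyRegular⇒equitable reg γ₁≡β₀ x = bySide (inLayer G C 0 x) refl
      where
      bySide : ∀ b → inLayer G C 0 x ≡ b →
        sameDeg (inLayer G C 0) x ≡ α 0 × crossDeg (inLayer G C 0) x ≡ β 0
      bySide true  x∈C = inside-degrees x x∈C
      bySide false x∉C =
        let same , cross = outside-degrees x x∉C
        in trans same (α₁≡α₀ reg γ₁≡β₀) , trans cross γ₁≡β₀

  2≤suc-supNorm : Fin n → ∀ u → (∀ x → u x ≢ ℤ.0ℤ) → 2 ≤ suc (supNorm G u)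
  2≤suc-supNorm x₀ u u≢0 =
    s≤s (ℕP.≤-trans (ℕP.n≢0⇒n>0 (u≢0 x₀ ∘ ℤP.∣i∣≡0⇒i≡0)) (≤maxF (λ x → ℤ.∣ u x ∣) x₀))

  IsM⇒2≤ : ∀ θ {m} → Fin n → IsM G θ m → 2 ≤ m
  IsM⇒2≤ θ x₀ ((u , (u≢0 , _) , refl) , _) = 2≤suc-supNorm x₀ u u≢0

  sign-eigenvector⇒IsM₂ : ∀ P θ → Fin n → SignEigenvector P θ → IsM G θ 2
  sign-eigenvector⇒IsM₂ P θ x₀ eig =
    (sign ∘ P , (sign≢0 ∘ P , eig) , cong suc (sym supNorm≡1)) ,
    λ u nzi → 2≤suc-supNorm x₀ u (proj₁ nzi)
    where
    supNorm≡1 : supNorm G (sign ∘ P) ≡ 1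
    supNorm≡1 = ℕP.≤-antisym
      (maxF≤ _ (λ x → ℕP.≤-reflexive (∣sign∣≡1 (P x))))
      (subst (_≤ supNorm G (sign ∘ P)) (∣sign∣≡1 (P x₀)) (≤maxF (λ x → ℤ.∣ sign (P x) ∣) x₀))

  IsM₂⇒sign-eigenvector : ∀ θ → IsM G θ 2 → Σ (Fin n → Bool) λ P → SignEigenvector P θ
  IsM₂⇒sign-eigenvector θ ((u , (u≢0 , eig) , 2≡1+supNorm) , _) = nonNegative ∘ u , λ x → begin
    applyA G (λ y → sign (nonNegative (u y)) / 1) x
      ≡⟨ applyA-cong (λ y → cong (_/ 1) (sym (u≡sign y))) x ⟩
    applyA G (λ y → u y / 1) x                      ≡⟨ eig x ⟩
    θ * (u x / 1)                                   ≡⟨ cong (λ i → θ * (i / 1)) (u≡sign x) ⟩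
    θ * (sign (nonNegative (u x)) / 1)              ∎
    where
    open ≡-Reasoning
    u≡sign : ∀ x → u x ≡ sign (nonNegative (u x))
    u≡sign x = unit≡sign (u x) (u≢0 x)
      (ℕP.≤-trans (≤maxF (λ x → ℤ.∣ u x ∣) x)
                  (ℕP.≤-reflexive (ℕP.suc-injective (sym 2≡1+supNorm))))

  RadiusOneCode : ℚ → Set
  RadiusOneCode θ = Σ (Subset n) λ C → Σ (ℕ → ℕ) λ α → Σ (ℕ → ℕ) λ β → Σ (ℕ → ℕ) λ γ →
    CompletelyRegular G C 1 α β γ × γ 1 ≡ β 0 × CodeEigenvalue 1 α β γ θ

  IsM₂⇒radiusOneCode : ∀ {k} θ → Regular G k → θ ℚ.< fromℕ k → Fin n →
    IsM G θ 2 → RadiusOneCode θ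
  IsM₂⇒radiusOneCode θ regular θ<k x₀ isM₂ =
    tabulate P , const a , atZero b , const b ,
    equitable⇒completelyRegular P equitable b≢0 x₀ , refl ,
    subst (CodeEigenvalue 1 (const a) (atZero b) (const b)) (sym θ≡a-b) (bipartition-codeEigenvalue a b)
    where
    P : Fin n → Bool
    P = proj₁ (IsM₂⇒sign-eigenvector θ isM₂)
    eig : SignEigenvector P θ
    eig = proj₂ (IsM₂⇒sign-eigenvector θ isM₂)
    a b : ℕ
    a = sameDeg P x₀
    b = crossDeg P x₀
    equitable : EquitableBipartition P a b
    equitable = sign-eigenvector⇒equitable {θ = θ} P regular eig x₀
    θ≡a-b : θ ≡ fromℕ a - fromℕ b
    θ≡a-b = sym (sign-eigenvector⇒difference P {θ} eig x₀)
    b≢0 : b ≢ 0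
    b≢0 = difference<sum⇒≢0 θ≡a-b (θ<sum (sameDeg+crossDeg regular P x₀) θ<k)

  radiusOneCode⇒IsM₂ : ∀ {k} θ → Connected G → Regular G k → θ ℚ.< fromℕ k → Fin n →
    RadiusOneCode θ → IsM G θ 2
  radiusOneCode⇒IsM₂ θ connected regular θ<k x₀ (C , α , β , γ , cr , γ₁≡β₀ , codeEigenvalue) =
    sign-eigenvector⇒IsM₂ (inLayer G C 0) θ x₀ (subst (SignEigenvector (inLayer G C 0)) (sym θ≡a-b)
      (equitable⇒sign-eigenvector (inLayer G C 0) equitable))
    where
    open CoveringRadiusOne {C} {α} {β} {γ} connected cr
    equitable : EquitableBipartition (inLayer G C 0) (α 0) (β 0)
    equitable = completelyRegular⇒equitable regular γ₁≡β₀
    θ≡a-b : θ ≡ fromℕ (α 0) - fromℕ (β 0)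
    θ≡a-b = tridiag-eigenvalue {α} {β} {γ} {θ} codeEigenvalue (α₁≡α₀ regular γ₁≡β₀) γ₁≡β₀
      (ℚP.<⇒≢ (θ<sum (equitable-degree (inLayer G C 0) regular equitable x₀) θ<k))

proposition2 : ∀ {n} (G : Graph n) → DistanceRegular G →
    (θ : ℚ) → IsEigenvalue G θ →
    -- θ = θ_i(Γ) with i ≥ 1 : θ is not the largest eigenvalue
    (∃ λ θ′ → IsEigenvalue G θ′ × θ ℚ.< θ′) →
    (∀ m → IsM G θ m → 2 ≤ m) ×
    (IsM G θ 2 ⇔
      (Σ (Subset n) λ C → Σ (ℕ → ℕ) λ α → Σ (ℕ → ℕ) λ β → Σ (ℕ → ℕ) λ γ →
        CompletelyRegular G C 1 α β γ × γ 1 ≡ β 0 × CodeEigenvalue 1 α β γ θ))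
proposition2 G (connected , (k , regular) , _) θ (_ , (x₀ , _) , _)
             (θ′ , (_ , (_ , v′≢0) , eig′) , θ<θ′) =
  (λ _ → IsM⇒2≤ G θ x₀) ,
  mk⇔ (IsM₂⇒radiusOneCode G θ regular θ<k x₀) (radiusOneCode⇒IsM₂ G θ connected regular θ<k x₀)
  where
  θ<k : θ ℚ.< fromℕ k
  θ<k = ℚP.<-≤-trans θ<θ′ (eigenvalue≤degree G regular eig′ v′≢0)
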